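{- Let $d>1$. For any $\varepsilon>0$ and $K\ge1$, $\mathcal{S}\mathcal{H}^d_{\varepsilon,K}\subset\mathcal{A}^d_{4\varepsilon,K}$.
   Context: $Gr_d$ is the set of finite simple graphs of maximum degree at most $d$. For $G\in Gr_d$, a set $Y\subset V(G)$ is a $K$-separator if after removing $Y$ (and incident edges) every connected component has at most $K$ vertices; $\operatorname{Sep}(G,K)$ is the set of $K$-separators. $G$ is strongly $(\varepsilon,K)$-hyperfinite if there is a probability measure $\mu$ on $\operatorname{Sep}(G,K)$ with $\mu(\{Y: x\in Y\})<\varepsilon$ for every $x\in V(G)$; $\mathcal{S}\mathcal{H}^d_{\varepsilon,K}$ is the set of such graphs in $Gr_d$. $G\in Gr_d$ is $(\varepsilon,r)$-uniform if there is $\tilde f:V(G)\to\operatorname{Prob}(G)$ (probability measures on $V(G)$) with $\sum_z|\tilde f(x)(z)-\tilde f(y)(z)|<\varepsilon$ for all adjacent $x,y$ and $\operatorname{Supp}(\tilde f(x))$ contained in the set of vertices at distance at most $r$ from $x$; $\mathcal{A}^d_{\varepsilon,r}$ is the set of such graphs.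
   Formalization: The parameter ε and the weights of the probability measure μ on $\operatorname{Sep}(G,K)$ are rational, and the values of $\tilde f$ are taken in ℚ. -}

module Defs where

open import Data.Nat as ℕ using (ℕ; zero; suc)
open import Data.Fin using (Fin; zero; suc)
open import Data.Fin.Subset as Sub using (Subset; _∈_; _∉_)
open import Data.Bool using (Bool; true; false; if_then_else_)
open import Data.Vec using (lookup)
open import Data.List using (List; []; _∷_)
open import Data.Product using (Σ; _×_; _,_; ∃)
open import Data.Rational as ℚ using (ℚ; 0ℚ; 1ℚ)
open import Relation.Binary.PropositionalEquality using (_≡_; _≢_)

record Graph : Set where
  field
    n     : ℕ
    adj   : Fin n → Fin n → Bool
    sym   : ∀ x y → adj x y ≡ adj y x
    irref : ∀ x → adj x x ≡ false
open Graph public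

sumFinℕ : ∀ {m} → (Fin m → ℕ) → ℕ
sumFinℕ {zero}  f = 0
sumFinℕ {suc m} f = f zero ℕ.+ sumFinℕ (λ i → f (suc i))

sumFinℚ : ∀ {m} → (Fin m → ℚ) → ℚ
sumFinℚ {zero}  f = 0ℚ
sumFinℚ {suc m} f = f zero ℚ.+ sumFinℚ (λ i → f (suc i))

degree : (G : Graph) → Fin (n G) → ℕ
degree G x = sumFinℕ (λ y → if adj G x y then 1 else 0)

InGr : ℕ → Graph → Set
InGr d G = ∀ x → degree G x ℕ.≤ d

data ReachAvoid (G : Graph) (Y : Subset (n G)) (x : Fin (n G)) : Fin (n G) → Set where
  here : x ∉ Y → ReachAvoid G Y x x
  step : ∀ {y z} → ReachAvoid G Y x y → adj G y z ≡ true → z ∉ Y → ReachAvoid G Y x z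

-- Y is a K-separator: every component of G - Y has at most K vertices,
-- i.e. every set of vertices all lying in the component of some x ∉ Y has size ≤ K.
IsSeparator : (G : Graph) → ℕ → Subset (n G) → Set
IsSeparator G K Y = ∀ (x : Fin (n G)) → x ∉ Y → ∀ (S : Subset (n G)) →
  (∀ z → z ∈ S → ReachAvoid G Y x z) → Sub.∣ S ∣ ℕ.≤ K

-- A (finitely supported) probability measure on Sep(G,K):
-- a list of weighted K-separators, nonnegative weights summing to 1.
data AllSep (G : Graph) (K : ℕ) : List (Subset (n G) × ℚ) → Set where
  []  : AllSep G K []
  _∷_ : ∀ {Y w rest} → (IsSeparator G K Y × 0ℚ ℚ.≤ w) → AllSep G K rest → AllSep G K ((Y , w) ∷ rest)

totalWeight : ∀ {m} → List (Subset m × ℚ) → ℚ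
totalWeight []            = 0ℚ
totalWeight ((_ , w) ∷ l) = w ℚ.+ totalWeight l

massContaining : ∀ {m} → Fin m → List (Subset m × ℚ) → ℚ
massContaining x []            = 0ℚ
massContaining x ((Y , w) ∷ l) = (if lookup Y x then w else 0ℚ) ℚ.+ massContaining x l

SepMeasure : (G : Graph) → ℕ → Set
SepMeasure G K = Σ (List (Subset (n G) × ℚ)) λ μ → AllSep G K μ × totalWeight μ ≡ 1ℚ

StronglyHyperfinite : (G : Graph) → ℚ → ℕ → Set
StronglyHyperfinite G ε K = Σ (SepMeasure G K) λ where
  (μ , _) → ∀ x → massContaining x μ ℚ.< ε

data Walk (G : Graph) : Fin (n G) → Fin (n G) → ℕ → Set where
  nil  : ∀ {x} → Walk G x x 0
  cons : ∀ {x y z m} → adj G x y ≡ true → Walk G y z m → Walk G x z (suc m)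

DistLe : (G : Graph) → Fin (n G) → Fin (n G) → ℕ → Set
DistLe G x z r = ∃ λ m → Walk G x z m × m ℕ.≤ r

IsProb : (G : Graph) → (Fin (n G) → ℚ) → Set
IsProb G p = (∀ z → 0ℚ ℚ.≤ p z) × sumFinℚ p ≡ 1ℚ

Uniform : (G : Graph) → ℚ → ℕ → Set
Uniform G ε r = Σ (Fin (n G) → Fin (n G) → ℚ) λ f →
  (∀ x → IsProb G (f x)) ×
  (∀ x y → adj G x y ≡ true → sumFinℚ (λ z → ℚ.∣ f x z ℚ.- f y z ∣) ℚ.< ε) ×
  (∀ x z → f x z ≢ 0ℚ → DistLe G x z r)

module Submission where

-- For a K-separator Y send each vertex x to a chosen vertex of the ball of radius K around x in
-- G − Y. For x ∉ Y that ball is the whole component of x, because components have at most K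
-- vertices, so the choice is constant along edges avoiding Y. Let f(x) be the μ-average of the
-- point masses at these vertices. Along an edge xy only the separators meeting {x, y} move mass,
-- each by at most 2μ(Y), so ‖f(x) − f(y)‖₁ ≤ 2(μ{Y ∋ x} + μ{Y ∋ y}) < 4ε.

open import Defs hiding (sym)
open import Data.Nat using (ℕ; _<_; _≤_)
open import Data.Rational using (ℚ; 0ℚ) renaming (_<_ to _<ℚ_; _+_ to _+ℚ_)

open import Algebra.Bundles using (CommutativeMonoid)
import Algebra.Properties.CommutativeSemigroup as CommutativeSemigroupProperties
open import Data.Bool using (true; false; if_then_else_)
import Data.Bool.Properties as Bool
open import Data.Fin using (Fin; zero; suc; _≟_)
open import Data.Fin.Properties using (any?)
open import Data.Fin.Subset using (Subset; _∈_; _∉_; _⊆_; _⊂_; _∪_; _∩_; ∁; ⁅_⁆; ∣_∣; Nonempty)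
open import Data.Fin.Subset.Properties
  using (_∈?_; nonempty?; ⊆-refl; ⊆-trans; ⊆-reflexive; ⊆-antisym; p⊂q⇒∣p∣<∣q∣; p⊆p∪q;
         x∈p∪q⁺; x∈p∪q⁻; x∈p∩q⁺; x∈p∩q⁻; x∉p⇒x∈∁p; x∈∁p⇒x∉p; x∈⁅x⁆; x∈⁅y⁆⇒x≡y; ∣⁅x⁆∣≡1)
open import Data.List using (List; []; _∷_)
open import Data.Nat using (zero; suc; _+_; _∸_; z≤n; s≤s)
open import Data.Nat.GeneralisedArithmetic using (fold; fold-+)
import Data.Nat.Properties as ℕ
open import Data.Product using (∃; _×_; _,_; proj₁; proj₂)
open import Data.Rational using (_-_; -_) renaming (_≤_ to _≤ℚ_; ∣_∣ to ∣_∣ℚ)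
import Data.Rational.Properties as ℚₚ
open import Data.Sum using (_⊎_; inj₁; inj₂)
open import Data.Vec using (lookup; tabulate)
open import Data.Vec.Properties using (lookup∘tabulate; []=⇒lookup; lookup⇒[]=)
open import Relation.Nullary using (yes; no; contradiction)
open import Relation.Nullary.Decidable using (does; dec-true; decidable-stable; _×-dec_; ¬?)
open import Relation.Unary using (Pred; Decidable)
open import Relation.Binary.PropositionalEquality
  using (_≡_; _≢_; refl; sym; trans; cong; cong₂; subst; module ≡-Reasoning)

module _ {m : ℕ} where

  subsetOf : ∀ {p} {P : Pred (Fin m) p} → Decidable P → Subset m
  subsetOf P? = tabulate (λ z → does (P? z))

  ∈-subsetOf⁺ : ∀ {p} {P : Pred (Fin m) p} (P? : Decidable P) {z} → P z → z ∈ subsetOf P?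
  ∈-subsetOf⁺ P? {z} pz = lookup⇒[]= z _ (trans (lookup∘tabulate _ z) (dec-true (P? z) pz))

  ∈-subsetOf⁻ : ∀ {p} {P : Pred (Fin m) p} (P? : Decidable P) {z} → z ∈ subsetOf P? → P z
  ∈-subsetOf⁻ P? {z} z∈ with P? z | trans (sym (lookup∘tabulate (λ z → does (P? z)) z)) ([]=⇒lookup z∈)
  ... | yes pz | _ = pz
  ... | no  _  | ()

  lookup≡false⇒∉ : ∀ {S : Subset m} {z} → lookup S z ≡ false → z ∉ S
  lookup≡false⇒∉ z∉S z∈S with trans (sym z∉S) ([]=⇒lookup z∈S)
  ... | ()

  ⊆⇒≡⊎⊂ : {S T : Subset m} → S ⊆ T → S ≡ T ⊎ S ⊂ T
  ⊆⇒≡⊎⊂ {S} {T} S⊆T with any? (λ z → z ∈? T ×-dec ¬? (z ∈? S))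
  ... | yes new = inj₂ (S⊆T , new)
  ... | no ¬new = inj₁ (⊆-antisym S⊆T T⊆S)
    where
    T⊆S : T ⊆ S
    T⊆S {z} z∈T = decidable-stable (z ∈? S) (λ z∉S → ¬new (z , z∈T , z∉S))

  choose : (S : Subset m) → Nonempty S → Fin m
  choose S ne with nonempty? S
  ... | yes (z , _) = z
  ... | no  _       = proj₁ ne

  choose-∈ : (S : Subset m) (ne : Nonempty S) → choose S ne ∈ S
  choose-∈ S ne with nonempty? S
  ... | yes (_ , z∈S) = z∈S
  ... | no  _         = proj₂ ne

  choose-cong : {S T : Subset m} (p : Nonempty S) (q : Nonempty T) → S ≡ T → choose S p ≡ choose T q
  choose-cong {S} p q refl with nonempty? S
  ... | yes _  = refl
  ... | no ¬ne = contradiction p ¬ne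

module _ {a} {A : Set a} (f : A → A) where

  fold-fixed : ∀ {S} → f S ≡ S → ∀ k → fold S f k ≡ S
  fold-fixed fix zero    = refl
  fold-fixed fix (suc k) = trans (cong f (fold-fixed fix k)) fix

  fold-fixed-after : ∀ {S j k} → f (fold S f j) ≡ fold S f j → j ≤ k → fold S f k ≡ fold S f j
  fold-fixed-after {S} {j} {k} fix j≤k = begin
    fold S f k                   ≡⟨ cong (fold S f) (sym (ℕ.m∸n+n≡m j≤k)) ⟩
    fold S f (k ∸ j + j)         ≡⟨ fold-+ S f (k ∸ j) ⟩
    fold (fold S f j) f (k ∸ j)  ≡⟨ fold-fixed fix (k ∸ j) ⟩
    fold S f j                   ∎
    where open ≡-Reasoning

  fold-unfoldˡ : ∀ S k → fold (f S) f k ≡ fold S f (suc k)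
  fold-unfoldˡ S zero    = refl
  fold-unfoldˡ S (suc k) = cong f (fold-unfoldˡ S k)

module _ {m : ℕ} (f : Subset m → Subset m) (f-inflationary : ∀ S → S ⊆ f S) where

  fold-inflationary : ∀ S k → S ⊆ fold S f k
  fold-inflationary S zero    = ⊆-refl
  fold-inflationary S (suc k) = ⊆-trans (fold-inflationary S k) (f-inflationary _)

  fold-grows-until-fixed : ∀ S k →
    (∃ λ j → j ≤ k × f (fold S f j) ≡ fold S f j) ⊎ k + ∣ S ∣ ≤ ∣ fold S f k ∣
  fold-grows-until-fixed S zero = inj₂ ℕ.≤-refl
  fold-grows-until-fixed S (suc k) with fold-grows-until-fixed S k
  ... | inj₁ (j , j≤k , fix) = inj₁ (j , ℕ.m≤n⇒m≤1+n j≤k , fix)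
  ... | inj₂ grown with ⊆⇒≡⊎⊂ (f-inflationary (fold S f k))
  ...   | inj₁ same   = inj₁ (k , ℕ.n≤1+n k , sym same)
  ...   | inj₂ bigger = inj₂ (ℕ.≤-<-trans grown (p⊂q⇒∣p∣<∣q∣ bigger))

  fold-stabilises : ∀ S c → ∣ fold S f c ∣ < c + ∣ S ∣ → f (fold S f c) ≡ fold S f c
  fold-stabilises S c small with fold-grows-until-fixed S c
  ... | inj₂ grown = contradiction grown (ℕ.<⇒≱ small)
  ... | inj₁ (j , j≤c , fix) = trans (cong f settled) (trans fix (sym settled))
    where
    settled : fold S f c ≡ fold S f j
    settled = fold-fixed-after f fix j≤c

fold-mono : ∀ {m} (f : Subset m → Subset m) → (∀ {S T} → S ⊆ T → f S ⊆ f T) →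
            ∀ {S T} → S ⊆ T → ∀ k → fold S f k ⊆ fold T f k
fold-mono f f-mono S⊆T zero    = S⊆T
fold-mono f f-mono S⊆T (suc k) = f-mono (fold-mono f f-mono S⊆T k)

Walk-snoc : ∀ {G : Graph} {x y z k} → Walk G x y k → adj G y z ≡ true → Walk G x z (suc k)
Walk-snoc nil        e = cons e nil
Walk-snoc (cons a w) e = cons a (Walk-snoc w e)

module Balls (G : Graph) where

  Vertex : Set
  Vertex = Fin (n G)

  AdjacentTo : Subset (n G) → Pred Vertex _
  AdjacentTo S z = ∃ λ y → y ∈ S × adj G y z ≡ true

  adjacentTo? : ∀ S → Decidable (AdjacentTo S)
  adjacentTo? S z = any? (λ y → y ∈? S ×-dec adj G y z Bool.≟ true)

  neighbours : Subset (n G) → Subset (n G)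
  neighbours S = subsetOf (adjacentTo? S)

  -- One step of breadth-first search in G − Y; the start set may meet Y.
  grow : Subset (n G) → Subset (n G) → Subset (n G)
  grow Y S = S ∪ (neighbours S ∩ ∁ Y)

  grow⁺ : ∀ Y S {y z} → y ∈ S → adj G y z ≡ true → z ∉ Y → z ∈ grow Y S
  grow⁺ Y S y∈S yz z∉Y =
    x∈p∪q⁺ (inj₂ (x∈p∩q⁺ (∈-subsetOf⁺ (adjacentTo? S) (_ , y∈S , yz) , x∉p⇒x∈∁p z∉Y)))

  grow⁻ : ∀ Y S {z} → z ∈ grow Y S →
          z ∈ S ⊎ (AdjacentTo S z × z ∉ Y)
  grow⁻ Y S z∈ with x∈p∪q⁻ S _ z∈
  ... | inj₁ z∈S = inj₁ z∈S
  ... | inj₂ z∈new with x∈p∩q⁻ (neighbours S) (∁ Y) z∈new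
  ...   | z∈N , z∈∁Y = inj₂ (∈-subsetOf⁻ (adjacentTo? S) z∈N , x∈∁p⇒x∉p z∈∁Y)

  grow-inflationary : ∀ Y S → S ⊆ grow Y S
  grow-inflationary Y S = p⊆p∪q _

  grow-mono : ∀ Y {S T} → S ⊆ T → grow Y S ⊆ grow Y T
  grow-mono Y {S} {T} S⊆T z∈ with grow⁻ Y S z∈
  ... | inj₁ z∈S                    = grow-inflationary Y T (S⊆T z∈S)
  ... | inj₂ ((y , y∈S , yz) , z∉Y) = grow⁺ Y T (S⊆T y∈S) yz z∉Y

  ball : Subset (n G) → ℕ → Vertex → Subset (n G)
  ball Y r x = fold ⁅ x ⁆ (grow Y) r

  centre∈ball : ∀ Y r x → x ∈ ball Y r x
  centre∈ball Y r x = fold-inflationary (grow Y) (grow-inflationary Y) ⁅ x ⁆ r (x∈⁅x⁆ x)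

  ∈ball⇒DistLe : ∀ Y r x {z} → z ∈ ball Y r x → DistLe G x z r
  ∈ball⇒DistLe Y zero x z∈ with x∈⁅y⁆⇒x≡y x z∈
  ... | refl = 0 , nil , z≤n
  ∈ball⇒DistLe Y (suc r) x z∈ with grow⁻ Y (ball Y r x) z∈
  ... | inj₁ z∈B with ∈ball⇒DistLe Y r x z∈B
  ...   | k , walk , k≤r = k , walk , ℕ.m≤n⇒m≤1+n k≤r
  ∈ball⇒DistLe Y (suc r) x z∈ | inj₂ ((y , y∈B , yz) , _) with ∈ball⇒DistLe Y r x y∈B
  ...   | k , walk , k≤r = suc k , Walk-snoc walk yz , s≤s k≤r

  ∈ball⇒ReachAvoid : ∀ Y r {x} → x ∉ Y → ∀ {z} → z ∈ ball Y r x → ReachAvoid G Y x z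
  ∈ball⇒ReachAvoid Y zero {x} x∉Y z∈ with x∈⁅y⁆⇒x≡y x z∈
  ... | refl = here x∉Y
  ∈ball⇒ReachAvoid Y (suc r) x∉Y z∈ with grow⁻ Y _ z∈
  ... | inj₁ z∈B                    = ∈ball⇒ReachAvoid Y r x∉Y z∈B
  ... | inj₂ ((y , y∈B , yz) , z∉Y) = step (∈ball⇒ReachAvoid Y r x∉Y y∈B) yz z∉Y

  module _ {K : ℕ} {Y : Subset (n G)} (sep : IsSeparator G K Y) where

    ∣ball∣≤ : ∀ r {x} → x ∉ Y → ∣ ball Y r x ∣ ≤ K
    ∣ball∣≤ r {x} x∉Y = sep x x∉Y (ball Y r x) (λ z → ∈ball⇒ReachAvoid Y r x∉Y)

    -- A component of G − Y has at most K vertices, so the search from x ∉ Y ends within K steps.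
    ball-stable : ∀ {x} → x ∉ Y → grow Y (ball Y K x) ≡ ball Y K x
    ball-stable {x} x∉Y = fold-stabilises (grow Y) (grow-inflationary Y) ⁅ x ⁆ K
      (ℕ.≤-<-trans (∣ball∣≤ K x∉Y) (ℕ.m<m+n K (ℕ.≤-reflexive (sym (∣⁅x⁆∣≡1 x)))))

    ball-adjacent-⊆ : ∀ {x y} → x ∉ Y → y ∉ Y → adj G x y ≡ true → ball Y K y ⊆ ball Y K x
    ball-adjacent-⊆ {x} {y} x∉Y y∉Y xy = ⊆-trans
      (fold-mono (grow Y) (grow-mono Y) ⁅y⁆⊆grow K)
      (⊆-reflexive (trans (fold-unfoldˡ (grow Y) ⁅ x ⁆ K) (ball-stable x∉Y)))
      where
      ⁅y⁆⊆grow : ⁅ y ⁆ ⊆ grow Y ⁅ x ⁆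
      ⁅y⁆⊆grow z∈ with x∈⁅y⁆⇒x≡y y z∈
      ... | refl = grow⁺ Y ⁅ x ⁆ (x∈⁅x⁆ x) xy y∉Y

    ball-adjacent : ∀ {x y} → x ∉ Y → y ∉ Y → adj G x y ≡ true → ball Y K x ≡ ball Y K y
    ball-adjacent {x} {y} x∉Y y∉Y xy = ⊆-antisym
      (ball-adjacent-⊆ y∉Y x∉Y (trans (Graph.sym G y x) xy))
      (ball-adjacent-⊆ x∉Y y∉Y xy)

  representative : ℕ → Subset (n G) → Vertex → Vertex
  representative r Y x = choose (ball Y r x) (x , centre∈ball Y r x)

  representative-DistLe : ∀ r Y x → DistLe G x (representative r Y x) r
  representative-DistLe r Y x = ∈ball⇒DistLe Y r x (choose-∈ (ball Y r x) _)

  representative-adjacent : ∀ {K Y x y} → IsSeparator G K Y → x ∉ Y → y ∉ Y → adj G x y ≡ true →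
                            representative K Y x ≡ representative K Y y
  representative-adjacent sep x∉Y y∉Y xy = choose-cong _ _ (ball-adjacent sep x∉Y y∉Y xy)

open CommutativeSemigroupProperties (CommutativeMonoid.commutativeSemigroup ℚₚ.+-0-commutativeMonoid)
  using (interchange)

sumFinℚ-cong : ∀ {m} {f g : Fin m → ℚ} → (∀ z → f z ≡ g z) → sumFinℚ f ≡ sumFinℚ g
sumFinℚ-cong {zero}  f≗g = refl
sumFinℚ-cong {suc m} f≗g = cong₂ _+ℚ_ (f≗g zero) (sumFinℚ-cong (λ z → f≗g (suc z)))

sumFinℚ-zero : ∀ m → sumFinℚ {m} (λ _ → 0ℚ) ≡ 0ℚ
sumFinℚ-zero zero    = refl
sumFinℚ-zero (suc m) = cong (0ℚ +ℚ_) (sumFinℚ-zero m)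

sumFinℚ-+ : ∀ {m} (f g : Fin m → ℚ) → sumFinℚ (λ z → f z +ℚ g z) ≡ sumFinℚ f +ℚ sumFinℚ g
sumFinℚ-+ {zero}  f g = refl
sumFinℚ-+ {suc m} f g = trans
  (cong (f zero +ℚ g zero +ℚ_) (sumFinℚ-+ (λ z → f (suc z)) (λ z → g (suc z))))
  (interchange (f zero) (g zero) _ _)

sumFinℚ-mono : ∀ {m} {f g : Fin m → ℚ} → (∀ z → f z ≤ℚ g z) → sumFinℚ f ≤ℚ sumFinℚ g
sumFinℚ-mono {zero}  f≤g = ℚₚ.≤-refl
sumFinℚ-mono {suc m} f≤g = ℚₚ.+-mono-≤ (f≤g zero) (sumFinℚ-mono (λ z → f≤g (suc z)))

p≤p+q : ∀ p {q} → 0ℚ ≤ℚ q → p ≤ℚ p +ℚ q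
p≤p+q p 0≤q = ℚₚ.≤-trans (ℚₚ.≤-reflexive (sym (ℚₚ.+-identityʳ p))) (ℚₚ.+-monoʳ-≤ p 0≤q)

pointMass : ∀ {m} → ℚ → Fin m → Fin m → ℚ
pointMass w p z = if does (p ≟ z) then w else 0ℚ

if-nonneg : ∀ b {w} → 0ℚ ≤ℚ w → 0ℚ ≤ℚ (if b then w else 0ℚ)
if-nonneg true  0≤w = 0≤w
if-nonneg false 0≤w = ℚₚ.≤-refl

pointMass-nonneg : ∀ {m w} (p z : Fin m) → 0ℚ ≤ℚ w → 0ℚ ≤ℚ pointMass w p z
pointMass-nonneg p z = if-nonneg (does (p ≟ z))

sum-pointMass : ∀ {m} w (p : Fin m) → sumFinℚ (pointMass w p) ≡ w
sum-pointMass {suc m} w zero    = trans (cong (w +ℚ_) (sumFinℚ-zero m)) (ℚₚ.+-identityʳ w)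
sum-pointMass {suc m} w (suc p) = trans (ℚₚ.+-identityˡ _) (sum-pointMass w p)

∣a-b∣≤a+b : ∀ {a b} → 0ℚ ≤ℚ a → 0ℚ ≤ℚ b → ∣ a - b ∣ℚ ≤ℚ a +ℚ b
∣a-b∣≤a+b {a} {b} 0≤a 0≤b = ℚₚ.≤-trans (ℚₚ.∣p-q∣≤∣p∣+∣q∣ a b)
  (ℚₚ.≤-reflexive (cong₂ _+ℚ_ (ℚₚ.0≤p⇒∣p∣≡p 0≤a) (ℚₚ.0≤p⇒∣p∣≡p 0≤b)))

∣a+b-c+d∣≤∣a-c∣+∣b-d∣ : ∀ a b c d → ∣ (a +ℚ b) - (c +ℚ d) ∣ℚ ≤ℚ ∣ a - c ∣ℚ +ℚ ∣ b - d ∣ℚ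
∣a+b-c+d∣≤∣a-c∣+∣b-d∣ a b c d = subst (λ t → ∣ t ∣ℚ ≤ℚ ∣ a - c ∣ℚ +ℚ ∣ b - d ∣ℚ)
  (sym (trans (cong (a +ℚ b +ℚ_) (ℚₚ.neg-distrib-+ c d)) (interchange a b (- c) (- d))))
  (ℚₚ.∣p+q∣≤∣p∣+∣q∣ (a - c) (b - d))

pointMass-distance : ∀ {m w} → 0ℚ ≤ℚ w → (p q : Fin m) →
  sumFinℚ (λ z → ∣ pointMass w p z - pointMass w q z ∣ℚ) ≤ℚ w +ℚ w
pointMass-distance {m} {w} 0≤w p q = ℚₚ.≤-trans
  (sumFinℚ-mono (λ z → ∣a-b∣≤a+b (pointMass-nonneg p z 0≤w) (pointMass-nonneg q z 0≤w)))
  (ℚₚ.≤-reflexive (trans (sumFinℚ-+ (pointMass w p) (pointMass w q))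
                        (cong₂ _+ℚ_ (sum-pointMass w p) (sum-pointMass w q))))

pointMass-distance-self : ∀ {m} w (p : Fin m) →
  sumFinℚ (λ z → ∣ pointMass w p z - pointMass w p z ∣ℚ) ≡ 0ℚ
pointMass-distance-self {m} w p =
  trans (sumFinℚ-cong (λ z → cong ∣_∣ℚ (ℚₚ.+-inverseʳ (pointMass w p z)))) (sumFinℚ-zero m)

module Mixture (G : Graph) (K : ℕ) (pick : Subset (n G) → Fin (n G) → Fin (n G)) where

  mixture : List (Subset (n G) × ℚ) → Fin (n G) → Fin (n G) → ℚ
  mixture []            x z = 0ℚ
  mixture ((Y , w) ∷ μ) x z = pointMass w (pick Y x) z +ℚ mixture μ x z

  mixture-nonneg : ∀ {μ} → AllSep G K μ → ∀ x z → 0ℚ ≤ℚ mixture μ x z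
  mixture-nonneg []                         x z = ℚₚ.≤-refl
  mixture-nonneg {(Y , w) ∷ μ} ((_ , 0≤w) ∷ seps) x z =
    ℚₚ.+-mono-≤ (pointMass-nonneg (pick Y x) z 0≤w) (mixture-nonneg seps x z)

  sum-mixture : ∀ μ x → sumFinℚ (mixture μ x) ≡ totalWeight μ
  sum-mixture []            x = sumFinℚ-zero (n G)
  sum-mixture ((Y , w) ∷ μ) x = trans (sumFinℚ-+ (pointMass w (pick Y x)) (mixture μ x))
    (cong₂ _+ℚ_ (sum-pointMass w (pick Y x)) (sum-mixture μ x))

  mixture-support : ∀ μ {x z} → mixture μ x z ≢ 0ℚ → ∃ λ Y → pick Y x ≡ z
  mixture-support []            nonzero = contradiction refl nonzero
  mixture-support ((Y , w) ∷ μ) {x} {z} nonzero with pick Y x ≟ z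
  ... | yes pickYx≡z = Y , pickYx≡z
  ... | no  _          = mixture-support μ (λ is0 → nonzero (trans (ℚₚ.+-identityˡ _) is0))

  massAt : Subset (n G) → ℚ → Fin (n G) → ℚ
  massAt Y w x = if lookup Y x then w else 0ℚ

  module _ (pick-adjacent : ∀ {Y x y} → IsSeparator G K Y → x ∉ Y → y ∉ Y → adj G x y ≡ true →
                           pick Y x ≡ pick Y y) where

    -- The two point masses coincide unless the separator contains x or y.
    pointMass-pick-distance : ∀ {Y w} → IsSeparator G K Y → 0ℚ ≤ℚ w → ∀ {x y} → adj G x y ≡ true →
      sumFinℚ (λ z → ∣ pointMass w (pick Y x) z - pointMass w (pick Y y) z ∣ℚ) ≤ℚ
        (massAt Y w x +ℚ massAt Y w y) +ℚ (massAt Y w x +ℚ massAt Y w y)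
    pointMass-pick-distance {Y} {w} sep 0≤w {x} {y} xy with lookup Y x in x∈?Y
    ... | true = ℚₚ.≤-trans (pointMass-distance 0≤w (pick Y x) (pick Y y)) (ℚₚ.+-mono-≤ w≤ w≤)
      where
      w≤ : w ≤ℚ w +ℚ massAt Y w y
      w≤ = p≤p+q w (if-nonneg (lookup Y y) 0≤w)
    ... | false with lookup Y y in y∈?Y
    ...   | true = ℚₚ.≤-trans (pointMass-distance 0≤w (pick Y x) (pick Y y))
                     (ℚₚ.≤-reflexive (sym (cong₂ _+ℚ_ (ℚₚ.+-identityˡ w) (ℚₚ.+-identityˡ w))))
    ...   | false = ℚₚ.≤-reflexive (trans
                      (cong (λ q → sumFinℚ (λ z → ∣ pointMass w (pick Y x) z - pointMass w q z ∣ℚ))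
                            (sym (pick-adjacent sep (lookup≡false⇒∉ x∈?Y) (lookup≡false⇒∉ y∈?Y) xy)))
                      (pointMass-distance-self w (pick Y x)))

    mixture-distance : ∀ {μ} → AllSep G K μ → ∀ {x y} → adj G x y ≡ true →
      sumFinℚ (λ z → ∣ mixture μ x z - mixture μ y z ∣ℚ) ≤ℚ
        (massContaining x μ +ℚ massContaining y μ) +ℚ (massContaining x μ +ℚ massContaining y μ)
    mixture-distance [] xy = ℚₚ.≤-reflexive (sumFinℚ-zero (n G))
    mixture-distance {(Y , w) ∷ μ} ((sep , 0≤w) ∷ seps) {x} {y} xy = begin
        sumFinℚ (λ z → ∣ (p z +ℚ r x z) - (q z +ℚ r y z) ∣ℚ)
      ≤⟨ sumFinℚ-mono (λ z → ∣a+b-c+d∣≤∣a-c∣+∣b-d∣ (p z) (r x z) (q z) (r y z)) ⟩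
        sumFinℚ (λ z → ∣ p z - q z ∣ℚ +ℚ ∣ r x z - r y z ∣ℚ)
      ≡⟨ sumFinℚ-+ (λ z → ∣ p z - q z ∣ℚ) (λ z → ∣ r x z - r y z ∣ℚ) ⟩
        sumFinℚ (λ z → ∣ p z - q z ∣ℚ) +ℚ sumFinℚ (λ z → ∣ r x z - r y z ∣ℚ)
      ≤⟨ ℚₚ.+-mono-≤ (pointMass-pick-distance sep 0≤w xy) (mixture-distance seps xy) ⟩
        (hx +ℚ hy +ℚ (hx +ℚ hy)) +ℚ (mx +ℚ my +ℚ (mx +ℚ my))
      ≡⟨ interchange (hx +ℚ hy) (hx +ℚ hy) (mx +ℚ my) (mx +ℚ my) ⟩
        (hx +ℚ hy +ℚ (mx +ℚ my)) +ℚ (hx +ℚ hy +ℚ (mx +ℚ my))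
      ≡⟨ cong (λ t → t +ℚ t) (interchange hx hy mx my) ⟩
        (hx +ℚ mx +ℚ (hy +ℚ my)) +ℚ (hx +ℚ mx +ℚ (hy +ℚ my))
      ∎
      where
      open ℚₚ.≤-Reasoning
      p = pointMass w (pick Y x)
      q = pointMass w (pick Y y)
      r = mixture μ
      hx = massAt Y w x
      hy = massAt Y w y
      mx = massContaining x μ
      my = massContaining y μ

proposition8p1 : (d : ℕ) → 1 < d → (ε : ℚ) → 0ℚ <ℚ ε → (K : ℕ) → 1 ≤ K →
    (G : Graph) → InGr d G → StronglyHyperfinite G ε K →
    Uniform G (ε +ℚ ε +ℚ ε +ℚ ε) K
proposition8p1 _ _ ε _ K _ G _ ((μ , seps , total) , mass<ε) =
  mixture μ , isProb , distance<4ε , support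
  where
  open Balls G
  open Mixture G K (representative K)

  isProb : ∀ x → IsProb G (mixture μ x)
  isProb x = mixture-nonneg seps x , trans (sum-mixture μ x) total

  distance<4ε : ∀ x y → adj G x y ≡ true →
    sumFinℚ (λ z → ∣ mixture μ x z - mixture μ y z ∣ℚ) <ℚ ε +ℚ ε +ℚ ε +ℚ ε
  distance<4ε x y xy = ℚₚ.≤-<-trans (mixture-distance representative-adjacent seps xy)
    (subst (_ <ℚ_) (sym (ℚₚ.+-assoc (ε +ℚ ε) ε ε)) (ℚₚ.+-mono-< mass<2ε mass<2ε))
    where
    mass<2ε : massContaining x μ +ℚ massContaining y μ <ℚ ε +ℚ ε
    mass<2ε = ℚₚ.+-mono-< (mass<ε x) (mass<ε y)

  support : ∀ x z → mixture μ x z ≢ 0ℚ → DistLe G x z K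
  support x z nonzero with mixture-support μ nonzero
  ... | Y , refl = representative-DistLe K Y x
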